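{- Let $k>1$ be an integer, $n\ge 1$, $\sigma$ a permutation of $\{0,1,\ldots,n\}$, and let $r=[a_0;a_1,\ldots,a_n]$ be a $(\sigma,k)$-permutiple with $r'=[a_{\sigma(0)};a_{\sigma(1)},\ldots,a_{\sigma(n)}]$. Let $(\gamma_j)$ and $(\gamma'_j)$ be the tails of $r$ and $r'$. Then the following are equivalent: (1) $r$ is continuant-preserving, i.e. $K_{n+1}(a_0,a_1,\ldots,a_n)=K_{n+1}(a_{\sigma(0)},a_{\sigma(1)},\ldots,a_{\sigma(n)})$; (2) $K_{n}(a_{\sigma(1)},\ldots,a_{\sigma(n)})=k\,K_{n}(a_1,\ldots,a_n)$; (3) $\gamma_0\gamma_1\cdots\gamma_{n-1}=k\,\gamma'_0\gamma'_1\cdots\gamma'_{n-1}$.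
   Context: For positive integers $a_0,\ldots,a_n$, $[a_0;a_1,\ldots,a_n]$ denotes the finite simple continued fraction $a_0+\cfrac{1}{a_1+\cfrac{1}{\ddots+\cfrac{1}{a_n}}}$. All finite continued fractions are assumed to be in canonical form (last digit at least $2$ when there are at least two digits). For an integer $k>1$ and a permutation $\sigma$ of $\{0,\ldots,n\}$, $r=[a_0;a_1,\ldots,a_n]$ is a $(\sigma,k)$-permutiple if $r=k\,[a_{\sigma(0)};a_{\sigma(1)},\ldots,a_{\sigma(n)}]$. Continuants: $K_0()=1$, $K_1(x_0)=x_0$, and $K_m(x_0,\ldots,x_{m-1})=x_{m-1}K_{m-1}(x_0,\ldots,x_{m-2})+K_{m-2}(x_0,\ldots,x_{m-3})$. Define $G:[0,\infty)\to[0,1)$ by $G(0)=0$ and $G(x)=\frac1x-\lfloor\frac1x\rfloor$ for $x>0$. The tails of $r$ are $\gamma_0=r-\lfloor r\rfloor$, $\gamma_{j+1}=G(\gamma_j)$; the tails $\gamma'_j$ of $r'$ are defined in the same way from $r'$. -}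

module Defs where

open import Data.Nat using (ℕ; zero; suc; _+_; _*_; _≤_)
open import Data.Fin using (Fin; zero; suc; fromℕ; inject₁)
open import Data.Integer using (+_)
open import Data.Rational using (ℚ; 0ℚ; 1ℚ; _/_; 1/_; floor; ≢-nonZero)
  renaming (_+_ to _+ℚ_; _*_ to _*ℚ_; _-_ to _-ℚ_)
open import Data.Rational.Properties using (_≟_)
open import Data.Fin.Permutation using (Permutation′; _⟨$⟩ʳ_)
open import Function using (_∘_)
open import Relation.Nullary using (yes; no)
open import Relation.Binary.PropositionalEquality using (_≡_)

ℕtoℚ : ℕ → ℚ
ℕtoℚ m = (+ m) / 1

K : (m : ℕ) → (Fin m → ℕ) → ℕ
K zero x = 1
K (suc zero) x = x zero
K (suc (suc m)) x =
  x (fromℕ (suc m)) * K (suc m) (x ∘ inject₁) + K m (x ∘ inject₁ ∘ inject₁)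

-- total reciprocal (1/0 := 0; never used at 0 for positive digits)
recip : ℚ → ℚ
recip x with x ≟ 0ℚ
... | yes _ = 0ℚ
... | no x≢0 = 1/_ x {{≢-nonZero x≢0}}

cf : (m : ℕ) → (Fin (suc m) → ℕ) → ℚ
cf zero a = ℕtoℚ (a zero)
cf (suc m) a = ℕtoℚ (a zero) +ℚ recip (cf m (a ∘ suc))

frac : ℚ → ℚ
frac x = x -ℚ ((floor x) / 1)

G : ℚ → ℚ
G x with x ≟ 0ℚ
... | yes _ = 0ℚ
... | no x≢0 = frac (1/_ x {{≢-nonZero x≢0}})

tail : ℚ → ℕ → ℚ
tail r zero = frac r
tail r (suc j) = G (tail r j)

tailProd : ℚ → ℕ → ℚ
tailProd r zero = 1ℚ
tailProd r (suc m) = tailProd r m *ℚ tail r m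

permDigits : {n : ℕ} → Permutation′ (suc n) → (Fin (suc n) → ℕ) → Fin (suc n) → ℕ
permDigits σ a = a ∘ (σ ⟨$⟩ʳ_)

Canonical : (n : ℕ) → (Fin (suc n) → ℕ) → Set
Canonical zero a = 1 ≤ a zero
Canonical (suc n) a = (∀ i → 1 ≤ a i) × (2 ≤ a (fromℕ (suc n)))
  where open import Data.Product using (_×_)

IsPermutiple : (n : ℕ) → Permutation′ (suc n) → ℕ → (Fin (suc n) → ℕ) → Set
IsPermutiple n σ k a = cf n a ≡ ℕtoℚ k *ℚ cf n (permDigits σ a)

module Submission where

-- Write p = K_{n+1}(a_0,…,a_n), q = K_n(a_1,…,a_n), and p', q' for the same
-- continuants of the permuted digits b = a ∘ σ.  Two classical identities
-- for a canonical continued fraction r = [a_0;…;a_m] drive the proof: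
--   (A) r · K_m(a_1,…,a_m) = K_{m+1}(a_0,…,a_m)            (cf-continuant)
--   (B) γ_0 γ_1 ⋯ γ_{m-1} · K_m(a_1,…,a_m) = 1            (tailProd-continuant)
-- Both follow by induction on m, peeling off the first digit: (A) uses the
-- expansion of a continuant along its first entry, (B) uses that the tails
-- of [a_0;a_1,…] are 1/[a_1;…] followed by the tails of [a_1;…], which rests
-- on ⌊a_0 + t⌋ = a_0 for 0 ≤ t < 1.
-- For a permutiple r = k r', identity (A) gives p q' = k p' q, so (1) ⇔ (2)
-- is cancellation in ℕ; identity (B) says the tail products are 1/q and
-- 1/q', so (2) ⇔ (3) is the statement that inversion maps q' = k q to
-- 1/q = k (1/q').

open import Defs
open import Data.Nat using (ℕ; suc; _≤_)
open import Data.Fin using (Fin; suc)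
open import Data.Product using (_×_)
open import Data.Rational using (ℚ) renaming (_*_ to _*ℚ_)
open import Data.Fin.Permutation using (Permutation′)
open import Function using (_∘_)
open import Function.Bundles using (_⇔_)
open import Relation.Binary.PropositionalEquality using (_≡_)
open import Data.Nat using (_*_)

open import Data.Nat as ℕ using (zero; _+_; _<_; NonZero; z≤n; s≤s)
open import Data.Nat.Properties as ℕP using ()
open import Data.Nat.DivMod as ℕD using ()
open import Data.Nat.Tactic.RingSolver using (solve-∀)
open import Data.Nat.Coprimality using (Coprime; 1-coprimeTo)
  renaming (sym to coprime-sym)
open import Data.Integer as ℤ using (+_; -[1+_])
open import Data.Integer.Properties as ℤP using ()
open import Data.Rational as ℚ using (mkℚ; 0ℚ; 1ℚ; 1/_; floor; toℚᵘ; ↥_; ≢-nonZero)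
open import Data.Rational.Properties as ℚP using ()
open import Data.Rational.Unnormalised as ℚᵘ using (mkℚᵘ; *≡*)
open import Data.Rational.Unnormalised.Properties as ℚᵘP using ()
open import Data.Rational.Solver using (module +-*-Solver)
open import Data.Fin using (fromℕ; inject₁) renaming (zero to fzero; suc to fsuc)
open import Data.Product using (_,_; proj₁)
open import Data.Empty using (⊥-elim)
open import Function.Bundles using (mk⇔)
open import Function.Construct.Composition using (_⇔-∘_)
open import Relation.Nullary using (yes; no)
open import Relation.Binary.PropositionalEquality
  using (refl; sym; trans; cong; cong₂; subst; subst₂; _≢_; module ≡-Reasoning)

coprime-1 : ∀ m → Coprime m 1
coprime-1 m = coprime-sym (1-coprimeTo m)

ℕtoℚ-mkℚ : ∀ m → ℕtoℚ m ≡ mkℚ (+ m) 0 (coprime-1 m)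
ℕtoℚ-mkℚ m = ℚP.normalize-coprime (coprime-1 m)

ℕtoℚᵘ : ∀ m → toℚᵘ (ℕtoℚ m) ≡ mkℚᵘ (+ m) 0
ℕtoℚᵘ m rewrite ℕtoℚ-mkℚ m = refl

-- ℕtoℚ is a semiring homomorphism; both laws are checked on unnormalised
-- fractions, where they are identities between integer numerators.
ℕtoℚ-+ : ∀ m n → ℕtoℚ (m + n) ≡ ℕtoℚ m ℚ.+ ℕtoℚ n
ℕtoℚ-+ m n = ℚP.toℚᵘ-injective
  (ℚᵘP.≃-trans unnormalised (ℚᵘP.≃-sym (ℚP.toℚᵘ-homo-+ (ℕtoℚ m) (ℕtoℚ n))))
  where
  unnormalised : toℚᵘ (ℕtoℚ (m + n)) ℚᵘ.≃ toℚᵘ (ℕtoℚ m) ℚᵘ.+ toℚᵘ (ℕtoℚ n)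
  unnormalised rewrite ℕtoℚᵘ (m + n) | ℕtoℚᵘ m | ℕtoℚᵘ n =
    *≡* (cong (ℤ._* + 1) (trans (ℤP.pos-+ m n)
      (sym (cong₂ ℤ._+_ (ℤP.*-identityʳ (+ m)) (ℤP.*-identityʳ (+ n))))))

ℕtoℚ-* : ∀ m n → ℕtoℚ (m * n) ≡ ℕtoℚ m ℚ.* ℕtoℚ n
ℕtoℚ-* m n = ℚP.toℚᵘ-injective
  (ℚᵘP.≃-trans unnormalised (ℚᵘP.≃-sym (ℚP.toℚᵘ-homo-* (ℕtoℚ m) (ℕtoℚ n))))
  where
  unnormalised : toℚᵘ (ℕtoℚ (m * n)) ℚᵘ.≃ toℚᵘ (ℕtoℚ m) ℚᵘ.* toℚᵘ (ℕtoℚ n)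
  unnormalised rewrite ℕtoℚᵘ (m * n) | ℕtoℚᵘ m | ℕtoℚᵘ n =
    *≡* (cong (ℤ._* + 1) (ℤP.pos-* m n))

ℕtoℚ-injective : ∀ {m n} → ℕtoℚ m ≡ ℕtoℚ n → m ≡ n
ℕtoℚ-injective {m} {n} eq rewrite ℕtoℚ-mkℚ m | ℕtoℚ-mkℚ n =
  ℤP.+-injective (cong ↥_ eq)

ℕtoℚ-mono-≤ : ∀ {m n} → m ≤ n → ℕtoℚ m ℚ.≤ ℕtoℚ n
ℕtoℚ-mono-≤ {m} {n} m≤n rewrite ℕtoℚ-mkℚ m | ℕtoℚ-mkℚ n =
  ℚ.*≤* (subst₂ ℤ._≤_ (sym (ℤP.*-identityʳ (+ m))) (sym (ℤP.*-identityʳ (+ n)))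
    (ℤ.+≤+ m≤n))

ℕtoℚ-mono-< : ∀ {m n} → m < n → ℕtoℚ m ℚ.< ℕtoℚ n
ℕtoℚ-mono-< {m} {n} m<n rewrite ℕtoℚ-mkℚ m | ℕtoℚ-mkℚ n =
  ℚ.*<* (subst₂ ℤ._<_ (sym (ℤP.*-identityʳ (+ m))) (sym (ℤP.*-identityʳ (+ n)))
    (ℤ.+<+ m<n))

ℕtoℚ-scaled : ∀ k x y → (y ≡ k * x) ⇔ (ℕtoℚ y ≡ ℕtoℚ k ℚ.* ℕtoℚ x)
ℕtoℚ-scaled k x y = mk⇔
  (λ y≡kx → trans (cong ℕtoℚ y≡kx) (ℕtoℚ-* k x))
  (λ eq → ℕtoℚ-injective (trans eq (sym (ℕtoℚ-* k x))))

0<1 : 0ℚ ℚ.< 1ℚ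
0<1 = ℕtoℚ-mono-< {0} {1} (s≤s z≤n)

/-unique : ∀ m N D .{{_ : NonZero D}} → m * D ≤ N → N < suc m * D → N ℕ./ D ≡ m
/-unique m N D lower upper = ℕP.≤-antisym
  (ℕP.<⇒≤pred (ℕD.m<n*o⇒m/o<n upper))
  (subst (ℕ._≤ N ℕ./ D) (ℕD.m*n/n≡m m D) (ℕD./-monoˡ-≤ D lower))

-- ⌊x⌋ = m whenever m ≤ x < m + 1; for x = N/(d+1) this is the bracket above.
floor-unique : ∀ m x → ℕtoℚ m ℚ.≤ x → x ℚ.< ℕtoℚ (suc m) → floor x ≡ + m
floor-unique m x lower upper
  rewrite ℕtoℚ-mkℚ m | ℕtoℚ-mkℚ (suc m) = bracket x lower upper
  where
  bracket : ∀ x → mkℚ (+ m) 0 (coprime-1 m) ℚ.≤ x →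
            x ℚ.< mkℚ (+ suc m) 0 (coprime-1 (suc m)) → floor x ≡ + m
  bracket (mkℚ (+ N) d _) (ℚ.*≤* lo) (ℚ.*<* hi) =
    trans (ℤP.*-identityˡ (+ (N ℕ./ suc d))) (cong +_ (/-unique m N (suc d) lo′ hi′))
    where
    lo′ : m * suc d ≤ N
    lo′ = ℤP.drop‿+≤+ (subst₂ ℤ._≤_ (sym (ℤP.pos-* m (suc d))) (ℤP.*-identityʳ (+ N)) lo)
    hi′ : N < suc m * suc d
    hi′ = ℤP.drop‿+<+ (subst₂ ℤ._<_ (ℤP.*-identityʳ (+ N)) (sym (ℤP.pos-* (suc m) (suc d))) hi)
  -- a negative x cannot lie above m ≥ 0
  bracket (mkℚ -[1+ N ] d _) (ℚ.*≤* lo) _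
    with subst₂ ℤ._≤_ (sym (ℤP.pos-* m (suc d))) (ℤP.*-identityʳ -[1+ N ]) lo
  ... | ()

frac-ℕ+ : ∀ m t → 0ℚ ℚ.≤ t → t ℚ.< 1ℚ → frac (ℕtoℚ m ℚ.+ t) ≡ t
frac-ℕ+ m t 0≤t t<1 = begin
  frac (ℕtoℚ m ℚ.+ t)       ≡⟨ cong (λ z → (ℕtoℚ m ℚ.+ t) ℚ.- (z ℚ./ 1))
                                  (floor-unique m (ℕtoℚ m ℚ.+ t) lower upper) ⟩
  (ℕtoℚ m ℚ.+ t) ℚ.- ℕtoℚ m ≡⟨ cong (ℚ._- ℕtoℚ m) (ℚP.+-comm (ℕtoℚ m) t) ⟩
  (t ℚ.+ ℕtoℚ m) ℚ.- ℕtoℚ m ≡⟨ ℚP.+-assoc t (ℕtoℚ m) (ℚ.- ℕtoℚ m) ⟩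
  t ℚ.+ (ℕtoℚ m ℚ.- ℕtoℚ m) ≡⟨ cong (t ℚ.+_) (ℚP.+-inverseʳ (ℕtoℚ m)) ⟩
  t ℚ.+ 0ℚ                  ≡⟨ ℚP.+-identityʳ t ⟩
  t                         ∎
  where
  open ≡-Reasoning
  lower : ℕtoℚ m ℚ.≤ ℕtoℚ m ℚ.+ t
  lower = subst (ℚ._≤ ℕtoℚ m ℚ.+ t) (ℚP.+-identityʳ (ℕtoℚ m)) (ℚP.+-monoʳ-≤ (ℕtoℚ m) 0≤t)
  upper : ℕtoℚ m ℚ.+ t ℚ.< ℕtoℚ (suc m)
  upper = subst (ℕtoℚ m ℚ.+ t ℚ.<_) (trans (ℚP.+-comm (ℕtoℚ m) 1ℚ) (sym (ℕtoℚ-+ 1 m)))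
    (ℚP.+-monoʳ-< (ℕtoℚ m) t<1)

recip-≢0 : ∀ c (c≢0 : c ≢ 0ℚ) → recip c ≡ (1/ c) {{≢-nonZero c≢0}}
recip-≢0 c c≢0 with c ℚP.≟ 0ℚ
... | yes c≡0 = ⊥-elim (c≢0 c≡0)
... | no _ = refl

G-≢0 : ∀ x (x≢0 : x ≢ 0ℚ) → G x ≡ frac ((1/ x) {{≢-nonZero x≢0}})
G-≢0 x x≢0 with x ℚP.≟ 0ℚ
... | yes x≡0 = ⊥-elim (x≢0 x≡0)
... | no _ = refl

recip-inverse : ∀ c → c ≢ 0ℚ → recip c ℚ.* c ≡ 1ℚ
recip-inverse c c≢0 rewrite recip-≢0 c c≢0 = ℚP.*-inverseˡ c {{≢-nonZero c≢0}}

recip-cancelˡ : ∀ c → c ≢ 0ℚ → ∀ x → recip c ℚ.* (c ℚ.* x) ≡ x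
recip-cancelˡ c c≢0 x = begin
  recip c ℚ.* (c ℚ.* x)  ≡⟨ sym (ℚP.*-assoc (recip c) c x) ⟩
  (recip c ℚ.* c) ℚ.* x  ≡⟨ cong (ℚ._* x) (recip-inverse c c≢0) ⟩
  1ℚ ℚ.* x               ≡⟨ ℚP.*-identityˡ x ⟩
  x                      ∎
  where open ≡-Reasoning

-- recip c · c = 1 rules out recip c = 0.
recip-≢0⇒≢0 : ∀ c → c ≢ 0ℚ → recip c ≢ 0ℚ
recip-≢0⇒≢0 c c≢0 recip≡0
  with trans (sym (recip-inverse c c≢0)) (trans (cong (ℚ._* c) recip≡0) (ℚP.*-zeroˡ c))
... | ()

pos⇒≢0 : ∀ {c} → 0ℚ ℚ.< c → c ≢ 0ℚ
pos⇒≢0 0<c c≡0 = ℚP.<⇒≢ 0<c (sym c≡0)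

recip-pos : ∀ c → 0ℚ ℚ.< c → 0ℚ ℚ.< recip c
recip-pos c 0<c rewrite recip-≢0 c (pos⇒≢0 0<c) =
  ℚP.positive⁻¹ _ {{ℚP.1/pos⇒pos c {{ℚ.positive 0<c}}}}

-- Numbers above 1 have reciprocal below 1: recip c ≥ 1 would force c = c·1 ≤ c·recip c = 1.
recip-<1 : ∀ c → 1ℚ ℚ.< c → recip c ℚ.< 1ℚ
recip-<1 c 1<c = ℚP.≰⇒> λ 1≤recip → ℚP.<-irrefl refl (ℚP.<-≤-trans 1<c (c≤1 1≤recip))
  where
  0<c = ℚP.<-trans 0<1 1<c
  c≤1 : 1ℚ ℚ.≤ recip c → c ℚ.≤ 1ℚ
  c≤1 1≤recip = subst₂ ℚ._≤_ (ℚP.*-identityˡ c) (recip-inverse c (pos⇒≢0 0<c))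
    (ℚP.*-monoʳ-≤-nonNeg c {{ℚ.nonNegative (ℚP.<⇒≤ 0<c)}} 1≤recip)

1/-cong : ∀ {x y} (x≡y : x ≡ y) (x≢0 : x ≢ 0ℚ) (y≢0 : y ≢ 0ℚ) →
          (1/ x) {{≢-nonZero x≢0}} ≡ (1/ y) {{≢-nonZero y≢0}}
1/-cong refl x≢0 y≢0 = refl

G-recip : ∀ c → c ≢ 0ℚ → G (recip c) ≡ frac c
G-recip c c≢0 = trans (G-≢0 (recip c) recip≢0) (cong frac 1/recip≡c)
  where
  recip≢0 = recip-≢0⇒≢0 c c≢0
  1/c≢0 : (1/ c) {{≢-nonZero c≢0}} ≢ 0ℚ
  1/c≢0 = subst (_≢ 0ℚ) (recip-≢0 c c≢0) recip≢0
  1/recip≡c : (1/ recip c) {{≢-nonZero recip≢0}} ≡ c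
  1/recip≡c = trans (1/-cong (recip-≢0 c c≢0) recip≢0 1/c≢0)
    (ℚP.1/-involutive c {{≢-nonZero c≢0}})

-- Defs expands K along its last entry; the induction on continued fractions
-- needs the expansion along the first entry,
-- K(x_0,x_1,…) = x_0 K(x_1,…) + K(x_2,…).
K-front : ∀ m (x : Fin (suc (suc m)) → ℕ) →
          K (suc (suc m)) x ≡ x fzero * K (suc m) (x ∘ fsuc) + K m (x ∘ fsuc ∘ fsuc)
K-front zero x = cong (_+ 1) (ℕP.*-comm (x (fsuc fzero)) (x fzero))
K-front (suc zero) x = length3 (x fzero) (x (fsuc fzero)) (x (fsuc (fsuc fzero)))
  where
  length3 : ∀ x₀ x₁ x₂ → x₂ * (x₁ * x₀ + 1) + x₀ ≡ x₀ * (x₂ * x₁ + 1) + x₂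
  length3 = solve-∀
K-front (suc (suc m)) x = begin
  xₗ * K (3 + m) (x ∘ inject₁) + K (2 + m) (x ∘ inject₁ ∘ inject₁)
    ≡⟨ cong₂ (λ u v → xₗ * u + v) (K-front (suc m) (x ∘ inject₁))
                                  (K-front m (x ∘ inject₁ ∘ inject₁)) ⟩
  xₗ * (x₀ * A + B) + (x₀ * C + D)
    ≡⟨ regroup xₗ x₀ A B C D ⟩
  x₀ * (xₗ * A + C) + (xₗ * B + D)
    ∎
  where
  open ≡-Reasoning
  xₗ = x (fromℕ (3 + m))
  x₀ = x fzero
  A = K (2 + m) (x ∘ fsuc ∘ inject₁)
  B = K (1 + m) (x ∘ fsuc ∘ fsuc ∘ inject₁)
  C = K (1 + m) (x ∘ fsuc ∘ inject₁ ∘ inject₁)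
  D = K m (x ∘ fsuc ∘ fsuc ∘ inject₁ ∘ inject₁)
  regroup : ∀ xₗ x₀ A B C D →
            xₗ * (x₀ * A + B) + (x₀ * C + D) ≡ x₀ * (xₗ * A + C) + (xₗ * B + D)
  regroup = solve-∀

K-pos : ∀ m (x : Fin m → ℕ) → (∀ i → 1 ≤ x i) → 1 ≤ K m x
K-pos zero x _ = s≤s z≤n
K-pos (suc zero) x pos = pos fzero
K-pos (suc (suc m)) x pos =
  ℕP.≤-trans (K-pos m (x ∘ inject₁ ∘ inject₁) (pos ∘ inject₁ ∘ inject₁)) (ℕP.m≤n+m _ _)

-- Digits of a canonical continued fraction [a_0;…;a_m]: all positive, the
-- last one at least 2.  For m ≥ 1 this is `Canonical m a` of Defs; unlike
-- that, it also constrains m = 0, which makes it stable under dropping the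
-- first digit.
CanonicalDigits : (m : ℕ) → (Fin (suc m) → ℕ) → Set
CanonicalDigits m a = (∀ i → 1 ≤ a i) × (2 ≤ a (fromℕ m))

canonical-tail : ∀ m a → CanonicalDigits (suc m) a → CanonicalDigits m (a ∘ fsuc)
canonical-tail m a (pos , last≥2) = pos ∘ fsuc , last≥2

-- A canonical continued fraction exceeds 1: either it is a single digit
-- ≥ 2, or it is a_0 + 1/r with a_0 ≥ 1 and r > 0.
cf>1 : ∀ m a → CanonicalDigits m a → 1ℚ ℚ.< cf m a
cf>1 zero a (_ , a₀≥2) = ℕtoℚ-mono-< a₀≥2
cf>1 (suc m) a can@(pos , _) =
  subst (ℚ._< cf (suc m) a) (ℚP.+-identityʳ 1ℚ)
    (ℚP.+-mono-≤-< (ℕtoℚ-mono-≤ (pos fzero)) (recip-pos r (ℚP.<-trans 0<1 1<r)))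
  where
  r = cf m (a ∘ fsuc)
  1<r = cf>1 m (a ∘ fsuc) (canonical-tail m a can)

cf≢0 : ∀ m a → CanonicalDigits m a → cf m a ≢ 0ℚ
cf≢0 m a can = pos⇒≢0 (ℚP.<-trans 0<1 (cf>1 m a can))

-- Writing
-- [a_0;…] = a_0 + 1/r with r = [a_1;…], induction gives r·K(a_2,…) = K(a_1,…),
-- and K-front reassembles the right-hand side.
cf-continuant : ∀ m a → CanonicalDigits m a →
                cf m a ℚ.* ℕtoℚ (K m (a ∘ fsuc)) ≡ ℕtoℚ (K (suc m) a)
cf-continuant zero a _ = ℚP.*-identityʳ (ℕtoℚ (a fzero))
cf-continuant (suc m) a can = begin
  (a₀ ℚ.+ recip r) ℚ.* P              ≡⟨ ℚP.*-distribʳ-+ P a₀ (recip r) ⟩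
  a₀ ℚ.* P ℚ.+ recip r ℚ.* P          ≡⟨ cong (λ u → a₀ ℚ.* P ℚ.+ recip r ℚ.* u) (sym rQ≡P) ⟩
  a₀ ℚ.* P ℚ.+ recip r ℚ.* (r ℚ.* Q)  ≡⟨ cong (a₀ ℚ.* P ℚ.+_) (recip-cancelˡ r r≢0 Q) ⟩
  a₀ ℚ.* P ℚ.+ Q                      ≡⟨ sym K-front-ℚ ⟩
  ℕtoℚ (K (suc (suc m)) a)            ∎
  where
  open ≡-Reasoning
  can′ = canonical-tail m a can
  a₀ = ℕtoℚ (a fzero)
  r = cf m (a ∘ fsuc)
  r≢0 = cf≢0 m (a ∘ fsuc) can′
  p = K (suc m) (a ∘ fsuc)
  q = K m (a ∘ fsuc ∘ fsuc)
  P = ℕtoℚ p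
  Q = ℕtoℚ q
  K-front-ℚ : ℕtoℚ (K (suc (suc m)) a) ≡ a₀ ℚ.* P ℚ.+ Q
  K-front-ℚ = begin
    ℕtoℚ (K (suc (suc m)) a)  ≡⟨ cong ℕtoℚ (K-front m a) ⟩
    ℕtoℚ (a fzero * p + q)    ≡⟨ ℕtoℚ-+ (a fzero * p) q ⟩
    ℕtoℚ (a fzero * p) ℚ.+ Q  ≡⟨ cong (ℚ._+ Q) (ℕtoℚ-* (a fzero) p) ⟩
    a₀ ℚ.* P ℚ.+ Q            ∎
  rQ≡P : r ℚ.* Q ≡ P
  rQ≡P = cf-continuant m (a ∘ fsuc) can′

-- γ_0 of [a_0;a_1,…] is 1/[a_1;…], because 0 < 1/[a_1;…] < 1.
frac-cf : ∀ m a → CanonicalDigits (suc m) a → frac (cf (suc m) a) ≡ recip (cf m (a ∘ fsuc))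
frac-cf m a can = frac-ℕ+ (a fzero) (recip r)
  (ℚP.<⇒≤ (recip-pos r (ℚP.<-trans 0<1 1<r))) (recip-<1 r 1<r)
  where
  r = cf m (a ∘ fsuc)
  1<r = cf>1 m (a ∘ fsuc) (canonical-tail m a can)

-- The tails of [a_0;a_1,…] after γ_0 are the tails of [a_1;…]:
-- γ_1 = G(1/[a_1;…]) = frac [a_1;…] is its γ_0, and G propagates the rest.
tail-cf-suc : ∀ m a → CanonicalDigits (suc m) a →
              ∀ j → tail (cf (suc m) a) (suc j) ≡ tail (cf m (a ∘ fsuc)) j
tail-cf-suc m a can zero =
  trans (cong G (frac-cf m a can)) (G-recip _ (cf≢0 m (a ∘ fsuc) (canonical-tail m a can)))
tail-cf-suc m a can (suc j) = cong G (tail-cf-suc m a can j)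

tailProd-shift : ∀ r s → (∀ j → tail r (suc j) ≡ tail s j) →
                 ∀ j → tailProd r (suc j) ≡ tail r 0 ℚ.* tailProd s j
tailProd-shift r s shift zero = trans (ℚP.*-identityˡ (tail r 0)) (sym (ℚP.*-identityʳ (tail r 0)))
tailProd-shift r s shift (suc j) = begin
  tailProd r (suc j) ℚ.* tail r (suc j)    ≡⟨ cong₂ ℚ._*_ (tailProd-shift r s shift j) (shift j) ⟩
  (tail r 0 ℚ.* tailProd s j) ℚ.* tail s j ≡⟨ ℚP.*-assoc (tail r 0) (tailProd s j) (tail s j) ⟩
  tail r 0 ℚ.* (tailProd s j ℚ.* tail s j) ∎
  where open ≡-Reasoning

-- Identity (B): γ_0 ⋯ γ_{m-1} · K_m(a_1,…,a_m) = 1.  With r = [a_1;…] the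
-- left side is (1/r · γ'_0 ⋯ γ'_{m-2}) · (r · K(a_2,…)) by (A), and the
-- induction hypothesis for [a_1;…] finishes.
tailProd-continuant : ∀ m a → CanonicalDigits m a →
                      tailProd (cf m a) m ℚ.* ℕtoℚ (K m (a ∘ fsuc)) ≡ 1ℚ
tailProd-continuant zero a _ = refl
tailProd-continuant (suc m) a can = begin
  tailProd (cf (suc m) a) (suc m) ℚ.* P  ≡⟨ cong₂ ℚ._*_ tailProd-split (sym rQ≡P) ⟩
  (recip r ℚ.* T) ℚ.* (r ℚ.* Q)         ≡⟨ swap-left (recip r) T (r ℚ.* Q) ⟩
  T ℚ.* (recip r ℚ.* (r ℚ.* Q))         ≡⟨ cong (T ℚ.*_) (recip-cancelˡ r r≢0 Q) ⟩
  T ℚ.* Q                               ≡⟨ tailProd-continuant m (a ∘ fsuc) can′ ⟩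
  1ℚ                                    ∎
  where
  open ≡-Reasoning
  can′ = canonical-tail m a can
  r = cf m (a ∘ fsuc)
  r≢0 = cf≢0 m (a ∘ fsuc) can′
  T = tailProd r m
  P = ℕtoℚ (K (suc m) (a ∘ fsuc))
  Q = ℕtoℚ (K m (a ∘ fsuc ∘ fsuc))
  rQ≡P : r ℚ.* Q ≡ P
  rQ≡P = cf-continuant m (a ∘ fsuc) can′
  tailProd-split : tailProd (cf (suc m) a) (suc m) ≡ recip r ℚ.* T
  tailProd-split = trans (tailProd-shift _ r (tail-cf-suc m a can) m)
    (cong (ℚ._* T) (frac-cf m a can))
  swap-left : ∀ x y z → (x ℚ.* y) ℚ.* z ≡ y ℚ.* (x ℚ.* z)
  swap-left x y z = trans (cong (ℚ._* z) (ℚP.*-comm x y)) (ℚP.*-assoc y x z)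

-- For r = k r' with r = [a_0;…;a_m] and r' = [b_0;…;b_m], cross-multiplying
-- identity (A) for both gives K(a) K(b_1,…) = k K(b) K(a_1,…).
permutiple-cross : ∀ m k a b → CanonicalDigits m a → CanonicalDigits m b →
                   cf m a ≡ ℕtoℚ k ℚ.* cf m b →
                   K (suc m) a * K m (b ∘ fsuc) ≡ k * (K (suc m) b * K m (a ∘ fsuc))
permutiple-cross m k a b can-a can-b r≡kr′ = ℕtoℚ-injective (begin
  ℕtoℚ (p * q′)              ≡⟨ ℕtoℚ-* p q′ ⟩
  ℕtoℚ p ℚ.* Q′              ≡⟨ cong (ℚ._* Q′) (sym (cf-continuant m a can-a)) ⟩
  (r ℚ.* Q) ℚ.* Q′           ≡⟨ cong (λ u → (u ℚ.* Q) ℚ.* Q′) r≡kr′ ⟩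
  ((κ ℚ.* r′) ℚ.* Q) ℚ.* Q′  ≡⟨ regroup κ r′ Q Q′ ⟩
  κ ℚ.* ((r′ ℚ.* Q′) ℚ.* Q)  ≡⟨ cong (λ u → κ ℚ.* (u ℚ.* Q)) (cf-continuant m b can-b) ⟩
  κ ℚ.* (ℕtoℚ p′ ℚ.* Q)      ≡⟨ cong (κ ℚ.*_) (sym (ℕtoℚ-* p′ q)) ⟩
  κ ℚ.* ℕtoℚ (p′ * q)        ≡⟨ sym (ℕtoℚ-* k (p′ * q)) ⟩
  ℕtoℚ (k * (p′ * q))        ∎)
  where
  open ≡-Reasoning
  p = K (suc m) a
  p′ = K (suc m) b
  q = K m (a ∘ fsuc)
  q′ = K m (b ∘ fsuc)
  Q = ℕtoℚ q
  Q′ = ℕtoℚ q′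
  κ = ℕtoℚ k
  r = cf m a
  r′ = cf m b
  regroup : ∀ κ r′ Q Q′ → ((κ ℚ.* r′) ℚ.* Q) ℚ.* Q′ ≡ κ ℚ.* ((r′ ℚ.* Q′) ℚ.* Q)
  regroup = solve 4 (λ κ r′ Q Q′ → ((κ :* r′) :* Q) :* Q′ := κ :* ((r′ :* Q′) :* Q)) refl
    where open +-*-Solver

-- Given p q' = k p' q with k, p, q nonzero, p = p' exactly when q' = k q:
-- cancel p in one direction and k q in the other.
cross-cancel : ∀ k p p′ q q′ .{{_ : NonZero k}} .{{_ : NonZero p}} .{{_ : NonZero q}} →
               p * q′ ≡ k * (p′ * q) → (p ≡ p′) ⇔ (q′ ≡ k * q)
cross-cancel k p p′ q q′ cross = mk⇔ to from
  where
  rearrange : ∀ k x q → k * (x * q) ≡ x * (k * q)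
  rearrange = solve-∀
  to : p ≡ p′ → q′ ≡ k * q
  to refl = ℕP.*-cancelˡ-≡ q′ (k * q) p (trans cross (rearrange k p q))
  from : q′ ≡ k * q → p ≡ p′
  from refl = ℕP.*-cancelʳ-≡ p p′ (k * q) {{ℕP.m*n≢0 k q}} (trans cross (rearrange k p′ q))

inverse-scaling : ∀ c x y T T′ → T ℚ.* x ≡ 1ℚ → T′ ℚ.* y ≡ 1ℚ →
                  (y ≡ c ℚ.* x) ⇔ (T ≡ c ℚ.* T′)
inverse-scaling c x y T T′ Tx≡1 T′y≡1 = mk⇔ to from
  where
  open +-*-Solver
  to : y ≡ c ℚ.* x → T ≡ c ℚ.* T′
  to refl = begin
    T                               ≡⟨ sym (ℚP.*-identityʳ T) ⟩
    T ℚ.* 1ℚ                        ≡⟨ cong (T ℚ.*_) (sym T′y≡1) ⟩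
    T ℚ.* (T′ ℚ.* (c ℚ.* x))        ≡⟨ solve 4 (λ T T′ c x →
                                         T :* (T′ :* (c :* x)) := (c :* T′) :* (T :* x))
                                       refl T T′ c x ⟩
    (c ℚ.* T′) ℚ.* (T ℚ.* x)        ≡⟨ cong ((c ℚ.* T′) ℚ.*_) Tx≡1 ⟩
    (c ℚ.* T′) ℚ.* 1ℚ               ≡⟨ ℚP.*-identityʳ (c ℚ.* T′) ⟩
    c ℚ.* T′                        ∎
    where open ≡-Reasoning
  from : T ≡ c ℚ.* T′ → y ≡ c ℚ.* x
  from refl = begin
    y                               ≡⟨ sym (ℚP.*-identityʳ y) ⟩
    y ℚ.* 1ℚ                        ≡⟨ cong (y ℚ.*_) (sym Tx≡1) ⟩
    y ℚ.* ((c ℚ.* T′) ℚ.* x)        ≡⟨ solve 4 (λ y c T′ x →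
                                         y :* ((c :* T′) :* x) := (c :* x) :* (T′ :* y))
                                       refl y c T′ x ⟩
    (c ℚ.* x) ℚ.* (T′ ℚ.* y)        ≡⟨ cong ((c ℚ.* x) ℚ.*_) T′y≡1 ⟩
    (c ℚ.* x) ℚ.* 1ℚ                ≡⟨ ℚP.*-identityʳ (c ℚ.* x) ⟩
    c ℚ.* x                         ∎
    where open ≡-Reasoning

-- (2) ⇔ (3): by identity (B) the tail products are the reciprocals of the
-- continuants K(a_1,…) and K(b_1,…).
tailProd-scaling : ∀ m k a b → CanonicalDigits m a → CanonicalDigits m b →
                   (K m (b ∘ fsuc) ≡ k * K m (a ∘ fsuc))
                   ⇔ (tailProd (cf m a) m ≡ ℕtoℚ k ℚ.* tailProd (cf m b) m)
tailProd-scaling m k a b can-a can-b =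
  inverse-scaling (ℕtoℚ k) _ _ _ _ (tailProd-continuant m a can-a) (tailProd-continuant m b can-b)
  ⇔-∘ ℕtoℚ-scaled k (K m (a ∘ fsuc)) (K m (b ∘ fsuc))

-- The theorem: (1) ⇔ (2) by cross-multiplication, (2) ⇔ (3) by tailProd-scaling;
-- the case n = 0 is excluded by 1 ≤ n.
theorem5 : (k n : ℕ) → 2 ≤ k → 1 ≤ n → (σ : Permutation′ (suc n)) →
    (a : Fin (suc n) → ℕ) →
    Canonical n a → Canonical n (permDigits σ a) →
    IsPermutiple n σ k a →
    ((K (suc n) a ≡ K (suc n) (permDigits σ a))
       ⇔ (K n (permDigits σ a ∘ suc) ≡ k * K n (a ∘ suc)))
    × ((K n (permDigits σ a ∘ suc) ≡ k * K n (a ∘ suc))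
       ⇔ (tailProd (cf n a) n ≡ ℕtoℚ k *ℚ tailProd (cf n (permDigits σ a)) n))
theorem5 k (suc n) 2≤k _ σ a can-a can-b permutiple =
  cross-cancel k _ _ _ _ (permutiple-cross (suc n) k a b can-a can-b permutiple) ,
  tailProd-scaling (suc n) k a b can-a can-b
  where
  b = permDigits σ a
  instance
    k≢0 : NonZero k
    k≢0 = ℕ.>-nonZero (ℕP.≤-trans (s≤s z≤n) 2≤k)
    p≢0 : NonZero (K (suc (suc n)) a)
    p≢0 = ℕ.>-nonZero (K-pos _ a (proj₁ can-a))
    q≢0 : NonZero (K (suc n) (a ∘ fsuc))
    q≢0 = ℕ.>-nonZero (K-pos _ (a ∘ fsuc) (proj₁ can-a ∘ fsuc))
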